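{- The misère remoteness $R^-$ of paths satisfies: 1. $R^-(P_1)=R^-(P_2)=1$; 2. $R^-(P_n)=2$ for every $n\ge 3$.
   Context: For $n\ge 0$, $P_n$ denotes the path on $n$ vertices ($P_0$ is the empty graph). A Node-Kayles move on a path $P_k$ with $k\ge 1$ chooses a vertex and deletes it together with its neighbours. The possible results are: $P_0$ if $k\in\{1,2\}$; $P_0$ or $P_1$ if $k=3$; and, for $k\ge 4$, $P_{k-2}$, $P_{k-3}$, or two paths $P_i,P_j$ with $j\ge i\ge1$, $i+j=k-3$. In the conjunctive compound game, a position $G$ is a finite multiset of paths (components). A move replaces every component simultaneously by the result of a Node-Kayles move on it; a split component yields two components. The set $O(G)$ of options of $G$ consists of all positions obtainable by one such move. In particular $O(G)=\emptyset$ as soon as some component is $P_0$. The misère remoteness $R^-$ is defined recursively as follows: - $R^-(G)=0$ if $O(G)=\emptyset$; - $R^-(G)=1+\min\{R^-(G'):G'\in O(G),\ R^-(G')\text{ odd}\}$ if some option has odd remoteness; - $R^-(G)=1+\max\{R^-(G'):G'\in O(G)\}$ otherwise, in which case all these values are even. $R^-(P_n)$ denotes the remoteness of the position consisting of the single component $P_n$. -}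

module Defs where

open import Data.Nat using (ℕ; zero; suc; _+_; _*_; _∸_; _≤ᵇ_)
open import Data.Bool using (Bool; true; false; if_then_else_)
open import Data.List using (List; []; _∷_; [_]; map; concatMap; upTo; filter; _++_)
open import Data.Nat.ListAction using (sum)
open import Data.Maybe using (Maybe; just; nothing)
open import Data.Nat using (_⊔_; _⊓_)

-- A position of the conjunctive compound: a finite multiset of paths,
-- represented as a list of path lengths (P_k is represented by k).
Position : Set
Position = List ℕ

-- Splits of P_k (k = m + 4) into two paths P_i, P_j with 1 ≤ i ≤ j, i + j = m + 1 = k - 3.
splits : ℕ → List Position
splits n = concatMap (λ i → if (suc i * 2) ≤ᵇ n then [ suc i ∷ (n ∸ suc i) ∷ [] ] else []) (upTo n)

-- Results of a single Node-Kayles move on P_k, each result being a list of components.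
pathMoves : ℕ → List Position
pathMoves zero = []
pathMoves (suc zero) = [ [ 0 ] ]
pathMoves (suc (suc zero)) = [ [ 0 ] ]
pathMoves (suc (suc (suc zero))) = [ 0 ] ∷ [ 1 ] ∷ []
pathMoves (suc (suc (suc (suc m)))) = [ suc (suc m) ] ∷ [ suc m ] ∷ splits (suc m)

allMoves : Position → List Position
allMoves [] = [ [] ]
allMoves (k ∷ G) = concatMap (λ r → map (r ++_) (allMoves G)) (pathMoves k)

-- The set O(G) of options (as a list; duplicates are harmless).
-- The empty position (no components) never arises from a single path and is
-- treated as terminal.
options : Position → List Position
options [] = []
options G@(_ ∷ _) = allMoves G

isOdd : ℕ → Bool
isOdd zero = false
isOdd (suc zero) = true
isOdd (suc (suc n)) = isOdd n

minOdd : List ℕ → Maybe ℕ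
minOdd [] = nothing
minOdd (r ∷ rs) with isOdd r | minOdd rs
... | true  | nothing = just r
... | true  | just m  = just (r ⊓ m)
... | false | mm      = mm

maxList : List ℕ → ℕ
maxList [] = 0
maxList (r ∷ rs) = r ⊔ maxList rs

combine : List ℕ → ℕ
combine [] = 0
combine rs@(_ ∷ _) with minOdd rs
... | just m  = suc m
... | nothing = suc (maxList rs)

remFuel : ℕ → Position → ℕ
remFuel zero G = 0
remFuel (suc f) G = combine (map (remFuel f) (options G))

size : Position → ℕ
size = sum

-- Every move on a nonempty position with no P_0
-- component removes at least one vertex, so the game tree of G has depth at
-- most size G + 1 and the fuel suc (size G) is sufficient: this computes
-- exactly the recursive definition of R^-.
R⁻ : Position → ℕ
R⁻ G = remFuel (suc (size G)) G

module Submission where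

open import Defs
open import Data.Nat using (ℕ; zero; suc; _+_; _≤_; z≤n; s≤s)
open import Data.Nat.Properties using (⊓-glb; ⊓-zeroʳ; +-identityʳ)
open import Data.List using ([]; _∷_; [_]; map)
open import Data.List.Properties using (++-identityʳ)
open import Data.List.Relation.Unary.All using (All; []; _∷_)
open import Data.List.Relation.Unary.Any using (here; there)
open import Data.List.Membership.Propositional using (_∈_)
open import Data.List.Membership.Propositional.Properties using (∈-map⁺)
open import Data.Maybe using (just; nothing)
open import Data.Bool using (true; false)
open import Data.Product using (_×_; _,_; ∃; ∃₂)
open import Relation.Binary.PropositionalEquality using (_≡_; refl; trans; cong; subst)

-- A position with a P₁ component has remoteness 1: every move turns that
-- component into P₀, so every option is terminal.  Hence any position having
-- such an option has remoteness 2, and every P_n with n ≥ 3 has one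
-- (P₁ itself for n = 3, 4, and P₁ + P_{n-4} for n ≥ 5).

isOdd⇒≥1 : ∀ r → isOdd r ≡ true → 1 ≤ r
isOdd⇒≥1 (suc r) _ = s≤s z≤n

minOdd⇒≥1 : ∀ rs {m} → minOdd rs ≡ just m → 1 ≤ m
minOdd⇒≥1 (r ∷ rs) eq with isOdd r in odd | minOdd rs in rest
minOdd⇒≥1 (r ∷ rs) refl | true  | nothing = isOdd⇒≥1 r odd
minOdd⇒≥1 (r ∷ rs) refl | true  | just k  = ⊓-glb (isOdd⇒≥1 r odd) (minOdd⇒≥1 rs rest)
minOdd⇒≥1 (r ∷ rs) eq   | false | _       = minOdd⇒≥1 rs (trans rest eq)

1∈⇒minOdd≡1 : ∀ {rs} → 1 ∈ rs → minOdd rs ≡ just 1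
1∈⇒minOdd≡1 {r ∷ rs} (here refl) with minOdd rs in rest
... | nothing = refl
... | just k with minOdd⇒≥1 rs rest
...   | s≤s _ = refl
1∈⇒minOdd≡1 {r ∷ rs} (there p) with isOdd r in odd | minOdd rs | 1∈⇒minOdd≡1 p
... | false | _ | refl = refl
... | true  | _ | refl with isOdd⇒≥1 r odd
...   | s≤s {n = k} _ = cong (λ m → just (suc m)) (⊓-zeroʳ k)

1∈⇒combine≡2 : ∀ {rs} → 1 ∈ rs → combine rs ≡ 2
1∈⇒combine≡2 {rs@(_ ∷ _)} p with minOdd rs | 1∈⇒minOdd≡1 p
... | _ | refl = refl

All≡0⇒minOdd≡nothing : ∀ {rs} → All (_≡ 0) rs → minOdd rs ≡ nothing
All≡0⇒minOdd≡nothing []            = refl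
All≡0⇒minOdd≡nothing (refl ∷ rest) = All≡0⇒minOdd≡nothing rest

All≡0⇒maxList≡0 : ∀ {rs} → All (_≡ 0) rs → maxList rs ≡ 0
All≡0⇒maxList≡0 []            = refl
All≡0⇒maxList≡0 (refl ∷ rest) = All≡0⇒maxList≡0 rest

All≡0⇒combine≡1 : ∀ {r rs} → All (_≡ 0) (r ∷ rs) → combine (r ∷ rs) ≡ 1
All≡0⇒combine≡1 (refl ∷ rest)
  rewrite All≡0⇒minOdd≡nothing rest | All≡0⇒maxList≡0 rest = refl

remFuel-0∷ : ∀ f G → remFuel f (0 ∷ G) ≡ 0
remFuel-0∷ zero    G = refl
remFuel-0∷ (suc f) G = refl

allMoves-1∷ : ∀ G → allMoves (1 ∷ G) ≡ map (0 ∷_) (allMoves G)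
allMoves-1∷ G = ++-identityʳ (map (0 ∷_) (allMoves G))

pathMoves-nonempty : ∀ k → ∃₂ λ r rs → pathMoves (suc k) ≡ r ∷ rs
pathMoves-nonempty zero                = _ , _ , refl
pathMoves-nonempty (suc zero)          = _ , _ , refl
pathMoves-nonempty (suc (suc zero))    = _ , _ , refl
pathMoves-nonempty (suc (suc (suc k))) = _ , _ , refl

allMoves-nonempty : ∀ G → All (1 ≤_) G → ∃₂ λ H Hs → allMoves G ≡ H ∷ Hs
allMoves-nonempty []          []           = _ , _ , refl
allMoves-nonempty (suc k ∷ G) (s≤s _ ∷ pos)
  with pathMoves (suc k) | pathMoves-nonempty k | allMoves G | allMoves-nonempty G pos
... | _ | _ , _ , refl | _ | _ , _ , refl = _ , _ , refl

remFuel-1∷ : ∀ f G → All (1 ≤_) G → remFuel (suc f) (1 ∷ G) ≡ 1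
remFuel-1∷ f G pos rewrite allMoves-1∷ G
  with allMoves G | allMoves-nonempty G pos
... | _ | H , Hs , refl = All≡0⇒combine≡1 (terminal (H ∷ Hs))
  where
  terminal : ∀ Hs → All (_≡ 0) (map (remFuel f) (map (0 ∷_) Hs))
  terminal []       = []
  terminal (H ∷ Hs) = remFuel-0∷ f H ∷ terminal Hs

P₁-option : ∀ m → ∃ λ G → All (1 ≤_) G × (1 ∷ G) ∈ allMoves [ 3 + m ]
P₁-option zero          = [] , [] , there (here refl)
P₁-option (suc zero)    = [] , [] , there (here refl)
P₁-option (suc (suc k)) = [ suc k ] , s≤s z≤n ∷ [] , there (there (here refl))

R⁻-P₃₊ : ∀ m → R⁻ [ 3 + m ] ≡ 2
R⁻-P₃₊ m with P₁-option m
... | G , pos , option rewrite +-identityʳ m =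
  1∈⇒combine≡2 (subst (_∈ _) (remFuel-1∷ (2 + m) G pos) (∈-map⁺ (remFuel (3 + m)) option))

theorem3 : (R⁻ [ 1 ] ≡ 1 × R⁻ [ 2 ] ≡ 1) × ((n : ℕ) → 3 ≤ n → R⁻ [ n ] ≡ 2)
theorem3 = (remFuel-1∷ 1 [] [] , refl) , λ { _ (s≤s (s≤s (s≤s (z≤n {m})))) → R⁻-P₃₊ m }
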